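{- Let $n,m$ be integers with $n\geq m\geq 0$. Then $$ gr_{3}(K_{3} : S(n,m))\geq \begin{cases} 5\cdot\frac{n}{2} +1 & \text{ if $n$ is even,}\\ 5\cdot\frac{n-1}{2} + 2 & \text{ if $n$ is odd.} \end{cases} $$
   Context: For integers $n\geq m\geq 0$, the double star $S(n,m)$ is the graph obtained from the disjoint union of the stars $K_{1,n}$ and $K_{1,m}$ by adding an edge between their centers. A coloring of a graph is rainbow if no two edges receive the same color. For a positive integer $k$ and a graph $H$, the Gallai-Ramsey number $gr_k(K_3 : H)$ is the minimum integer $N$ such that every coloring of the edges of the complete graph $K_N$ with (at most) $k$ colors contains either a rainbow triangle or a monochromatic copy of $H$. -}

module Defs where

open import Data.Nat using (ℕ; zero; suc; _+_; _*_; _≤_; _/_; _%_; _∸_)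
open import Data.Nat.Properties using ()
open import Data.Fin using (Fin; zero; suc; inject+; raise; _↑ˡ_; _↑ʳ_)
open import Data.Product using (Σ; ∃; _×_; _,_)
open import Data.Sum using (_⊎_)
open import Data.Empty using (⊥)
open import Relation.Nullary using (¬_)
open import Relation.Binary.PropositionalEquality using (_≡_; _≢_)
open import Function.Definitions using (Injective)

record Graph : Set₁ where
  field
    order : ℕ
    Adj   : Fin order → Fin order → Set

open Graph public

-- An edge-colouring of the complete graph K_N with k colours:
-- a symmetric function on pairs (values on the diagonal are irrelevant).
record Colouring (N k : ℕ) : Set where
  field
    col  : Fin N → Fin N → Fin k
    symm : ∀ i j → col i j ≡ col j i

open Colouring public

RainbowTriangle : ∀ {N k} → Colouring N k → Set
RainbowTriangle {N} c =
  Σ (Fin N) λ x → Σ (Fin N) λ y → Σ (Fin N) λ z →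
    (x ≢ y) × (y ≢ z) × (x ≢ z) ×
    (col c x y ≢ col c y z) × (col c y z ≢ col c x z) × (col c x y ≢ col c x z)

MonoCopy : ∀ {N k} → Colouring N k → Graph → Set
MonoCopy {N} {k} c H =
  Σ (Fin (order H) → Fin N) λ φ → Injective _≡_ _≡_ φ ×
    Σ (Fin k) λ a → ∀ u v → Adj H u v → col c (φ u) (φ v) ≡ a

GRArrows : ℕ → Graph → ℕ → Set
GRArrows k H N = (c : Colouring N k) → RainbowTriangle c ⊎ MonoCopy c H

-- Double star S(n,m) on vertex set Fin (2 + n + m):
-- vertex 0 = centre of K_{1,n}, vertex 1 = centre of K_{1,m},
-- vertices 2 .. n+1 = leaves of the first star, n+2 .. n+m+1 = leaves of the second.
data DSAdj (n m : ℕ) : Fin (2 + n + m) → Fin (2 + n + m) → Set where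
  centres  : DSAdj n m zero (suc zero)
  centres' : DSAdj n m (suc zero) zero
  leafL    : (i : Fin n) → DSAdj n m zero (suc (suc (i ↑ˡ m)))
  leafL'   : (i : Fin n) → DSAdj n m (suc (suc (i ↑ˡ m))) zero
  leafR    : (j : Fin m) → DSAdj n m (suc zero) (suc (suc (n ↑ʳ j)))
  leafR'   : (j : Fin m) → DSAdj n m (suc (suc (n ↑ʳ j))) (suc zero)

DoubleStar : ℕ → ℕ → Graph
DoubleStar n m = record { order = 2 + n + m ; Adj = DSAdj n m }

-- The lower bound from the paper:
--   5 * (n/2) + 1        if n is even
--   5 * ((n-1)/2) + 2    if n is odd   (n ∸ 1 is exact subtraction here since n ≥ 1)
dsBound : ℕ → ℕ
dsBound n with n % 2
... | zero  = 5 * (n / 2) + 1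
... | suc _ = 5 * ((n ∸ 1) / 2) + 2

module Submission where

-- Write n = 2h + e with
-- h = ⌊n/2⌋ and e = n mod 2; then dsBound n ≤ 5h + e + 1, so it suffices to
-- 3-colour K_M, M = 5h + e, with no rainbow triangle and no monochromatic
-- S(n,m) (arrowing is monotone in the number of vertices, arrows-mono).
--
-- The colouring (blowUp) is a blow-up of the 3-colouring of K₅ in which an
-- edge pq is coloured by the cyclic distance of p and q (distance 1 ↦ 0,
-- distance 2 ↦ 1, and 2 inside a part): vertex j of K_M lies in part j mod 5
-- and layer j div 5.  Rainbow triangles are excluded by a finite check on
-- the five parts.  Seen from any vertex, every colour covers at most two
-- parts, which together have at most 2h + e = n vertices; this is shown by
-- an injective "slot" map into Fin n (blowUp-monoStar-bound).  But the big
-- centre of a monochromatic S(n,m) has n + 1 neighbours of one colour.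

open import Defs
open import Data.Nat using (ℕ; zero; suc; _+_; _*_; _∸_; _≤_; _<_; _/_; _%_; z≤n; s≤s; NonZero; _≤?_; _<?_; _≟_)
open import Data.Nat.Properties
open import Data.Nat.DivMod using (_mod_; m≡m%n+[m/n]*n; m%n<n; [m+kn]%n≡m%n; m<n⇒m%n≡m; /-mono-≤)
open import Data.Fin using (Fin; toℕ; fromℕ<; inject≤; _↑ˡ_)
import Data.Fin.Properties as Finₚ
open import Data.Product using (Σ; _×_; _,_)
open import Data.Sum using (_⊎_; inj₁; inj₂)
open import Data.Empty using (⊥-elim)
open import Data.Unit using (tt)
open import Data.Bool using (if_then_else_)
open import Function using (_∘_)
open import Function.Definitions using (Injective)
open import Relation.Nullary using (¬_; yes; no; does)
open import Relation.Nullary.Decidable using (toWitness; _×-dec_; _⊎-dec_; _→-dec_)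
open import Relation.Binary.PropositionalEquality

arrows-mono : ∀ {k H N M} → N ≤ M → GRArrows k H N → GRArrows k H M
arrows-mono {k} {N = N} {M} N≤M arrows c with arrows restricted
  where
  restricted : Colouring N k
  restricted = record { col  = λ x y → col c (inject≤ x N≤M) (inject≤ y N≤M)
                      ; symm = λ x y → symm c (inject≤ x N≤M) (inject≤ y N≤M) }
... | inj₁ (x , y , z , x≢y , y≢z , x≢z , r₁ , r₂ , r₃) =
  inj₁ (ι x , ι y , ι z , x≢y ∘ ι-inj , y≢z ∘ ι-inj , x≢z ∘ ι-inj , r₁ , r₂ , r₃)
  where
  ι : Fin N → Fin M
  ι x = inject≤ x N≤M
  ι-inj : ∀ {x y} → ι x ≡ ι y → x ≡ y
  ι-inj {x} {y} = Finₚ.inject≤-injective N≤M N≤M x y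
... | inj₂ (φ , φ-inj , a , mono) =
  inj₂ ((λ u → inject≤ (φ u) N≤M)
       , (λ {u} {v} e → φ-inj (Finₚ.inject≤-injective N≤M N≤M (φ u) (φ v) e))
       , a , mono)

MonoStar : ∀ {N k} → Colouring N k → ℕ → Set
MonoStar {N} {k} c d =
  Σ (Fin N) λ v → Σ (Fin k) λ a → Σ (Fin d → Fin N) λ leaf →
    Injective _≡_ _≡_ leaf × (∀ i → col c v (leaf i) ≡ a)

-- The centre 0 of S(n,m) has the n + 1 neighbours 1 (the other centre) and
-- the n leaves of its own star; a monochromatic copy therefore yields a
-- monochromatic star with n + 1 leaves.
monoDoubleStar⇒monoStar : ∀ {N k} {c : Colouring N k} {n m} →
  MonoCopy c (DoubleStar n m) → MonoStar c (suc n)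
monoDoubleStar⇒monoStar {c = c} {n} {m} (φ , φ-inj , a , mono) =
  φ zero , a , φ ∘ neighbour , neighbour-inj ∘ φ-inj , neighbour-col
  where
  open Data.Fin using (zero; suc)
  neighbour : Fin (suc n) → Fin (2 + n + m)
  neighbour zero    = suc zero
  neighbour (suc i) = suc (suc (i ↑ˡ m))
  neighbour-inj : Injective _≡_ _≡_ neighbour
  neighbour-inj {zero}  {zero}  _ = refl
  neighbour-inj {suc i} {suc j} e =
    cong suc (Finₚ.↑ˡ-injective m i j (Finₚ.suc-injective (Finₚ.suc-injective e)))
  neighbour-col : ∀ i → col c (φ zero) (φ (neighbour i)) ≡ a
  neighbour-col zero    = mono _ _ centres
  neighbour-col (suc i) = mono _ _ (leafL i)

-- The colouring of K₅ by cyclic distance: colour 0 at distance 1, colour 1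
-- at distance 2, and colour 2 on the diagonal (used inside a part).
colourOfOffset : ℕ → Fin 3
colourOfOffset 0 = Fin.suc (Fin.suc Fin.zero)
colourOfOffset 1 = Fin.zero
colourOfOffset 4 = Fin.zero
colourOfOffset _ = Fin.suc Fin.zero

pentagon : Fin 5 → Fin 5 → Fin 3
pentagon p q = colourOfOffset ((toℕ q + 5 ∸ toℕ p) % 5)

pentagon-symm : ∀ p q → pentagon p q ≡ pentagon q p
pentagon-symm = toWitness {a? = Finₚ.all? λ p → Finₚ.all? λ q → pentagon p q Finₚ.≟ pentagon q p} tt

pentagon-noRainbow : ∀ p q s →
  pentagon p q ≡ pentagon q s ⊎ pentagon q s ≡ pentagon p s ⊎ pentagon p q ≡ pentagon p s
pentagon-noRainbow = toWitness {a? = Finₚ.all? λ p → Finₚ.all? λ q → Finₚ.all? λ s →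
  (pentagon p q Finₚ.≟ pentagon q s) ⊎-dec (pentagon q s Finₚ.≟ pentagon p s)
    ⊎-dec (pentagon p q Finₚ.≟ pentagon p s)} tt

-- Seen from part r, each colour is used on at most two parts.  The rank of
-- part p tells them apart: it is 1 if a smaller part has the same colour
-- from r as p, and 0 otherwise.
rank : Fin 5 → Fin 5 → ℕ
rank r p =
  if does (Finₚ.any? λ p′ → (toℕ p′ <? toℕ p) ×-dec (pentagon r p′ Finₚ.≟ pentagon r p))
  then 1 else 0

rank≤1 : ∀ r p → rank r p ≤ 1
rank≤1 = toWitness {a? = Finₚ.all? λ r → Finₚ.all? λ p → rank r p ≤? 1} tt

rank-zero : ∀ r → rank r Fin.zero ≡ 0
rank-zero = toWitness {a? = Finₚ.all? λ r → rank r Fin.zero ≟ 0} tt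

rank-injective : ∀ r p q → pentagon r p ≡ pentagon r q → rank r p ≡ rank r q → p ≡ q
rank-injective = toWitness {a? = Finₚ.all? λ r → Finₚ.all? λ p → Finₚ.all? λ q →
  (pentagon r p Finₚ.≟ pentagon r q) →-dec ((rank r p ≟ rank r q) →-dec (p Finₚ.≟ q))} tt

digits-unique : ∀ k .{{_ : NonZero k}} {a b c d} → b < k → d < k →
  b + a * k ≡ d + c * k → b ≡ d × a ≡ c
digits-unique k {a} {b} {c} {d} b<k d<k eq = b≡d , *-cancelʳ-≡ a c k (+-cancelˡ-≡ d _ _ eq′)
  where
  open ≡-Reasoning
  b≡d : b ≡ d
  b≡d = begin
    b               ≡⟨ sym (m<n⇒m%n≡m b<k) ⟩
    b % k           ≡⟨ sym ([m+kn]%n≡m%n b a k) ⟩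
    (b + a * k) % k ≡⟨ cong (_% k) eq ⟩
    (d + c * k) % k ≡⟨ [m+kn]%n≡m%n d c k ⟩
    d % k           ≡⟨ m<n⇒m%n≡m d<k ⟩
    d               ∎
  eq′ : d + a * k ≡ d + c * k
  eq′ = subst (λ x → x + a * k ≡ d + c * k) b≡d eq

layer-bound : ∀ {h e r q} → e ≤ 1 → r + q * 5 < 5 * h + e →
  q < h ⊎ (r ≡ 0 × q ≡ h × e ≡ 1)
layer-bound {h} {e} {r} {q} e≤1 lt with q <? h
... | yes q<h = inj₁ q<h
... | no q≮h = inj₂ (n<1⇒n≡0 (<-≤-trans r<e e≤1) , q≡h , ≤-antisym e≤1 (<-≤-trans (s≤s z≤n) r<e))
  where
  open ≤-Reasoning
  q*5<1+h*5 : q * 5 < suc (h * 5)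
  q*5<1+h*5 = begin-strict
    q * 5     ≤⟨ m≤n+m (q * 5) r ⟩
    r + q * 5 <⟨ lt ⟩
    5 * h + e ≤⟨ +-monoʳ-≤ (5 * h) e≤1 ⟩
    5 * h + 1 ≡⟨ +-comm (5 * h) 1 ⟩
    suc (5 * h) ≡⟨ cong suc (*-comm 5 h) ⟩
    suc (h * 5) ∎
  q≡h : q ≡ h
  q≡h = ≤-antisym (*-cancelʳ-≤ q h 5 (m<1+n⇒m≤n q*5<1+h*5)) (≮⇒≥ q≮h)
  r<e : r < e
  r<e = +-cancelʳ-< (h * 5) r e (begin-strict
    r + h * 5 ≡⟨ cong (λ x → r + x * 5) (sym q≡h) ⟩
    r + q * 5 <⟨ lt ⟩
    5 * h + e ≡⟨ +-comm (5 * h) e ⟩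
    e + 5 * h ≡⟨ cong (e +_) (*-comm 5 h) ⟩
    e + h * 5 ∎)

part : ∀ {M} → Fin M → Fin 5
part j = toℕ j mod 5

layer : ∀ {M} → Fin M → ℕ
layer j = toℕ j / 5

part-layer : ∀ {M} (j : Fin M) → toℕ j ≡ toℕ (part j) + layer j * 5
part-layer j = trans (m≡m%n+[m/n]*n (toℕ j) 5)
                     (cong (_+ layer j * 5) (sym (Finₚ.toℕ-fromℕ< (m%n<n (toℕ j) 5))))

part-layer-injective : ∀ {M} {i j : Fin M} → part i ≡ part j → layer i ≡ layer j → i ≡ j
part-layer-injective {i = i} {j} p≡ l≡ = Finₚ.toℕ-injective (begin
  toℕ i                          ≡⟨ part-layer i ⟩
  toℕ (part i) + layer i * 5     ≡⟨ cong₂ (λ p l → toℕ p + l * 5) p≡ l≡ ⟩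
  toℕ (part j) + layer j * 5     ≡⟨ sym (part-layer j) ⟩
  toℕ j                          ∎)
  where open ≡-Reasoning

blowUp : ∀ M → Colouring M 3
blowUp M = record { col  = λ x y → pentagon (part x) (part y)
                  ; symm = λ x y → pentagon-symm (part x) (part y) }

blowUp-noRainbow : ∀ M → ¬ RainbowTriangle (blowUp M)
blowUp-noRainbow M (x , y , z , _ , _ , _ , r₁ , r₂ , r₃)
  with pentagon-noRainbow (part x) (part y) (part z)
... | inj₁ e        = r₁ e
... | inj₂ (inj₁ e) = r₂ e
... | inj₂ (inj₂ e) = r₃ e

slot : ∀ {M} → Fin M → Fin M → ℕ
slot v j = rank (part v) (part j) + layer j * 2

slot-injective : ∀ {M} (v : Fin M) {i j : Fin M} →
  col (blowUp M) v i ≡ col (blowUp M) v j → slot v i ≡ slot v j → i ≡ j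
slot-injective v {i} {j} same-colour same-slot
  with digits-unique 2 (s≤s (rank≤1 (part v) (part i))) (s≤s (rank≤1 (part v) (part j))) same-slot
... | rank≡ , layer≡ =
  part-layer-injective (rank-injective (part v) (part i) (part j) same-colour rank≡) layer≡

-- For M = 5h + e with e ≤ 1 all slots are below 2h + e: ordinary layers
-- give slots at most 2q + 1 < 2h, and the extra vertex lies in part 0,
-- whose rank is 0, and has slot 2h.
slot-bound : ∀ h e → e ≤ 1 → (v j : Fin (5 * h + e)) → slot v j < e + h * 2
slot-bound h e e≤1 v j
  with layer-bound {h} {e} {toℕ (part j)} {layer j} e≤1 (subst (_< 5 * h + e) (part-layer j) (Finₚ.toℕ<n j))
... | inj₁ q<h = begin-strict
  rank (part v) (part j) + layer j * 2 ≤⟨ +-monoˡ-≤ (layer j * 2) (rank≤1 (part v) (part j)) ⟩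
  suc (layer j * 2)                    <⟨ *-monoˡ-≤ 2 q<h ⟩
  h * 2                                ≤⟨ m≤n+m (h * 2) e ⟩
  e + h * 2                            ∎
  where open ≤-Reasoning
... | inj₂ (r≡0 , q≡h , refl) = begin-strict
  rank (part v) (part j) + layer j * 2 ≡⟨ cong₂ (λ p q → rank (part v) p + q * 2) (Finₚ.toℕ-injective r≡0) q≡h ⟩
  rank (part v) Fin.zero + h * 2       ≡⟨ cong (_+ h * 2) (rank-zero (part v)) ⟩
  h * 2                                <⟨ n<1+n (h * 2) ⟩
  1 + h * 2                            ∎
  where open ≤-Reasoning

-- In the blow-up of K_{5h+e}, e ≤ 1, a monochromatic star has at most
-- 2h + e leaves: its leaves sit injectively in the slots below 2h + e.
blowUp-monoStar-bound : ∀ h e → e ≤ 1 → ∀ {d} → MonoStar (blowUp (5 * h + e)) d → d ≤ e + h * 2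
blowUp-monoStar-bound h e e≤1 {d} (v , a , leaf , leaf-inj , leaf-col) =
  Finₚ.injective⇒≤ {f = slotOf} slotOf-inj
  where
  slotOf : Fin d → Fin (e + h * 2)
  slotOf i = fromℕ< (slot-bound h e e≤1 v (leaf i))
  slotOf-inj : Injective _≡_ _≡_ slotOf
  slotOf-inj {i} {j} eq = leaf-inj (slot-injective v (trans (leaf-col i) (sym (leaf-col j)))
    (trans (sym (Finₚ.toℕ-fromℕ< _)) (trans (cong toℕ eq) (Finₚ.toℕ-fromℕ< _))))

-- K_M with M = 5⌊n/2⌋ + (n mod 2) does not arrow S(n,m): the blow-up has
-- no rainbow triangle, and a monochromatic S(n,m) would give a star with
-- n + 1 leaves although n = 2⌊n/2⌋ + (n mod 2).
blowUp-notArrow : ∀ n m → ¬ GRArrows 3 (DoubleStar n m) (5 * (n / 2) + n % 2)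
blowUp-notArrow n m arrows with arrows (blowUp (5 * (n / 2) + n % 2))
... | inj₁ rainbow = blowUp-noRainbow _ rainbow
... | inj₂ copy    = 1+n≰n (subst (suc n ≤_) (sym (m≡m%n+[m/n]*n n 2))
      (blowUp-monoStar-bound (n / 2) (n % 2) (m<1+n⇒m≤n (m%n<n n 2))
        (monoDoubleStar⇒monoStar {c = blowUp _} {n} {m} copy)))

dsBound≤ : ∀ n → dsBound n ≤ suc (5 * (n / 2) + n % 2)
dsBound≤ n with n % 2
... | zero  = ≤-reflexive (trans (+-comm (5 * (n / 2)) 1) (cong suc (sym (+-identityʳ _))))
... | suc k = begin
  5 * ((n ∸ 1) / 2) + 2     ≤⟨ +-monoˡ-≤ 2 (*-monoʳ-≤ 5 (/-mono-≤ (m∸n≤m n 1) ≤-refl)) ⟩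
  5 * (n / 2) + 2           ≤⟨ +-monoʳ-≤ (5 * (n / 2)) (s≤s (s≤s z≤n)) ⟩
  5 * (n / 2) + suc (suc k) ≡⟨ +-suc (5 * (n / 2)) (suc k) ⟩
  suc (5 * (n / 2) + suc k) ∎
  where open ≤-Reasoning

-- If N < dsBound n then N ≤ 5⌊n/2⌋ + (n mod 2), and by monotonicity K_N
-- arrowing S(n,m) would make the blow-up colouring arrow it too.
lemma1 : (n m : ℕ) → m ≤ n →
    (N : ℕ) → GRArrows 3 (DoubleStar n m) N → dsBound n ≤ N
lemma1 n m _ N arrows with dsBound n ≤? N
... | yes bound≤N = bound≤N
... | no  bound≰N = ⊥-elim (blowUp-notArrow n m (arrows-mono N≤M arrows))
  where
  N≤M : N ≤ 5 * (n / 2) + n % 2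
  N≤M = m<1+n⇒m≤n (<-≤-trans (≰⇒> bound≰N) (dsBound≤ n))
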